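{- Let $m,l\ge 2$ be integers. Then $\chi_{=}(K_1\circ^l P_m)=3$ if $m\in\{2,3,4,5\}$; $\chi_{=}(K_1\circ^l P_m)=4$ if $m\ge 6$ and $m$ is even; and $\chi_{=}(K_1\circ^l P_m)\le 4$ otherwise.
   Context: All graphs are finite, simple and connected. $K_1$ is the single-vertex graph and $P_m$ the path on $m$ vertices. A graph is equitably $k$-colorable if its vertex set can be partitioned into $k$ (possibly empty) independent sets $V_1,\dots,V_k$ with $||V_i|-|V_j||\le 1$ for all $i,j$; $\chi_{=}(G)$ is the least $k$ for which $G$ is equitably $k$-colorable. The corona $G\circ H$ is formed from one copy of $G$ and $|V(G)|$ copies of $H$, the $i$-th vertex of $G$ being joined to every vertex of the $i$-th copy of $H$; $G\circ^1 H=G\circ H$ and $G\circ^l H=(G\circ^{l-1}H)\circ H$ for $l\ge 2$. -}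

module Defs where

open import Data.Nat using (ℕ; zero; suc; _+_; _*_; _≤_; _<_; _≡ᵇ_)
open import Data.Bool using (Bool; true; false; _∧_; _∨_)
open import Data.Fin using (Fin; toℕ; splitAt; remQuot; _≟_)
open import Data.Product using (_×_; _,_; ∃)
open import Data.Sum using (inj₁; inj₂)
open import Data.List using (List; length; filter)
open import Data.Fin using () renaming (_≟_ to _≟F_)
open import Relation.Nullary using (¬_)
open import Relation.Nullary.Decidable using (⌊_⌋)
open import Relation.Binary.PropositionalEquality using (_≡_; _≢_)
import Data.List as L

-- A finite graph on the vertex set Fin size, with a Bool-valued adjacency.
-- (All graphs below are simple: adjacency is symmetric and irreflexive.)
record Graph : Set where
  constructor mkGraph
  field
    size : ℕ
    adj  : Fin size → Fin size → Bool
open Graph public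

K1 : Graph
K1 = mkGraph 1 (λ _ _ → false)

P : ℕ → Graph
P m = mkGraph m (λ u v → (suc (toℕ u) ≡ᵇ toℕ v) ∨ (suc (toℕ v) ≡ᵇ toℕ u))

-- Vertices: Fin (n + n * h); the first n are the vertices of G,
-- vertex  (i , j)  (encoded by Data.Fin.combine, decoded by remQuot) of the
-- second block is vertex j of the i-th copy of H.
_∘G_ : Graph → Graph → Graph
G ∘G H = mkGraph (n + n * h) a
  where
  n = size G
  h = size H
  a : Fin (n + n * h) → Fin (n + n * h) → Bool
  a x y with splitAt n x | splitAt n y
  ... | inj₁ u | inj₁ v = adj G u v
  ... | inj₁ u | inj₂ q with remQuot {n} h q
  ...   | (i , _) = ⌊ u ≟F i ⌋
  a x y | inj₂ p | inj₁ v with remQuot {n} h p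
  ...   | (i , _) = ⌊ v ≟F i ⌋
  a x y | inj₂ p | inj₂ q with remQuot {n} h p | remQuot {n} h q
  ...   | (i , j) | (i' , j') = ⌊ i ≟F i' ⌋ ∧ adj H j j'

-- Iterated corona:  G ∘^0 H = G,  G ∘^(l+1) H = (G ∘^l H) ∘ H
-- (so G ∘^1 H = G ∘ H as in the paper).
_∘^_⟨_⟩ : Graph → ℕ → Graph → Graph
G ∘^ zero ⟨ H ⟩ = G
G ∘^ suc l ⟨ H ⟩ = (G ∘^ l ⟨ H ⟩) ∘G H

Colouring : Graph → ℕ → Set
Colouring G k = Fin (size G) → Fin k

Proper : (G : Graph) {k : ℕ} → Colouring G k → Set
Proper G c = ∀ u v → adj G u v ≡ true → c u ≢ c v

classSize : (G : Graph) {k : ℕ} → Colouring G k → Fin k → ℕ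
classSize G c i = length (filter (λ v → c v ≟F i) (L.allFin (size G)))

Equitable : (G : Graph) {k : ℕ} → Colouring G k → Set
Equitable G c = ∀ i j → classSize G c i ≤ suc (classSize G c j)

-- G is equitably k-colourable (colour classes may be empty)
EqColourable : Graph → ℕ → Set
EqColourable G k = ∃ λ (c : Colouring G k) → Proper G c × Equitable G c

EqChromatic : Graph → ℕ → Set
EqChromatic G k = EqColourable G k × (∀ j → j < k → ¬ EqColourable G j)

-- Three colours are needed because every corona with a pendant path contains a triangle. For
-- m = 2h, a proper 3-colouring paints each pendant path alternately with the two colours
-- missing at its attachment vertex, so in G ∘ P_{2h} colour b has x_b + h(n − x_b) vertices,
-- where x_b counts colour b in G; for h ≥ 3 equitability upstairs forces x to be constant,
-- and descending to K₁ gives a contradiction.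
--
-- The colourings are built level by level, painting each pendant path with an eventually
-- periodic pattern that depends only on the colour of its attachment vertex, except at one
-- exceptional vertex. If every colour receives m vertices in total from the patterns of all
-- colours, a class-size vector U + e is sent to (1 + m)U + V + e′ with V constant and e′
-- depending on e only, so equitability is tracked by finitely many 0/1 shapes e. All
-- conditions are checked by evaluation; for path lengths m = p + tq they are checked
-- separately on the coefficients of 1, t and t².
module Submission where

open import Defs
open import Data.Bool using (true; false; _∧_; _∨_; if_then_else_)
open import Data.Bool.Properties using (∧-conicalˡ; ∧-conicalʳ; T-≡) renaming (_≟_ to _≟ᵇ_)
open import Data.Empty using (⊥-elim)
open import Data.Fin as Fin
  using (Fin; zero; suc; toℕ; #_; splitAt; remQuot; combine; punchIn; _↑ˡ_; _↑ʳ_)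
open import Data.Fin.Properties
  using (splitAt-↑ˡ; splitAt-↑ʳ; remQuot-combine; combine-remQuot; join-splitAt; toℕ-fromℕ<;
         punchInᵢ≢i; pigeonhole; all?; any?)
open import Data.List as List using (List; []; _∷_; _∷ʳ_; length; filter; tabulate)
open import Data.List.NonEmpty as List⁺ using (List⁺; _∷_; toList)
open import Data.List.Relation.Unary.All as All using (All; []; _∷_)
open import Data.List.Relation.Unary.Linked as Linked using (Linked; linked?)
open import Data.Nat as ℕ using (ℕ; zero; suc; _+_; _*_; _∸_; _≤_; _<_; _≡ᵇ_; z≤n; s≤s; _≤?_; NonZero)
open import Data.Nat.DivMod using (_mod_)
open import Data.Nat.Divisibility using (_∣_; divides)
open import Data.Nat.Properties
  using (+-0-commutativeMonoid; +-*-semiring; +-assoc; +-comm; +-identityʳ; +-cancelʳ-≡; +-monoʳ-≤;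
         ≤-refl; ≤-trans; ≤-reflexive; ≤-antisym; ≤-pred; <-≤-trans; ≤-<-connex; m≤m+n; n≤1+n;
         m≤n⇒m≤1+n; m+n≮m; m≤n⇒∃[o]m+o≡n; m<1+n⇒m<n∨m≡n; ≡ᵇ⇒≡; ≡⇒≡ᵇ)
open import Data.Nat.Tactic.RingSolver using (solve-∀)
open import Algebra.Properties.CommutativeMonoid.Sum +-0-commutativeMonoid
  using (sum; sum-cong-≗; ∑-distrib-+; ∑-comm; sum-remove; sum-replicate-zero)
open import Algebra.Properties.Semiring.Sum +-*-semiring using (*-distribˡ-sum; *-distribʳ-sum)
open import Data.Product using (Σ; ∃; _×_; _,_; proj₁; proj₂; swap)
open import Data.Sum using (_⊎_; inj₁; inj₂; [_,_]′)
import Data.Vec.Functional as Vector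
open import Function using (_∘_)
open import Function.Bundles using (Equivalence)
open import Level using (Level)
open import Relation.Binary.Core using (Rel)
open import Relation.Binary.PropositionalEquality
open import Relation.Nullary using (Dec; yes; no; does; ¬_)
open import Relation.Nullary.Decidable
  using (⌊_⌋; True; toWitness; fromWitness; from-yes; map′; _×-dec_; _→-dec_; ¬?)
open import Relation.Unary using (Pred)

private
  variable
    a ℓ : Level
    A : Set a

δ : ∀ {k} → Fin k → Fin k → ℕ
δ a b = if does (a Fin.≟ b) then 1 else 0

⌊≟⌋-refl : ∀ {k} (a : Fin k) → ⌊ a Fin.≟ a ⌋ ≡ true
⌊≟⌋-refl a = Equivalence.to T-≡ (fromWitness refl)

⌊≟⌋⇒≡ : ∀ {k} {a b : Fin k} → ⌊ a Fin.≟ b ⌋ ≡ true → a ≡ b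
⌊≟⌋⇒≡ e = toWitness (Equivalence.from T-≡ e)

∑-splitAt : ∀ p q (f : Fin (p + q) → ℕ) → sum f ≡ sum (λ i → f (i ↑ˡ q)) + sum (λ j → f (p ↑ʳ j))
∑-splitAt zero    q f = refl
∑-splitAt (suc p) q f = trans (cong (f zero +_) (∑-splitAt p q (f ∘ suc))) (sym (+-assoc (f zero) _ _))

∑-combine : ∀ n h (f : Fin (n * h) → ℕ) → sum f ≡ sum (λ i → sum (λ j → f (combine {n} {h} i j)))
∑-combine zero    h f = refl
∑-combine (suc n) h f =
  trans (∑-splitAt h (n * h) f) (cong (sum (λ j → f (j ↑ˡ n * h)) +_) (∑-combine n h (f ∘ (h ↑ʳ_))))

∑-const : ∀ n x → sum {n} (λ _ → x) ≡ n * x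
∑-const zero    x = refl
∑-const (suc n) x = cong (x +_) (∑-const n x)

∑-δ : ∀ {k} (x : Fin k) (w : Fin k → ℕ) → sum (λ a → δ x a * w a) ≡ w x
∑-δ {suc k} zero    w = trans (cong (w zero + 0 +_) (sum-replicate-zero k)) (trans (+-identityʳ _) (+-identityʳ _))
∑-δ {suc k} (suc x) w = ∑-δ x (w ∘ suc)

∑-by-colour : ∀ {n k} (c : Fin n → Fin k) (w : Fin k → ℕ) →
  sum (λ i → w (c i)) ≡ sum (λ a → sum (λ i → δ (c i) a) * w a)
∑-by-colour c w = begin
  sum (λ i → w (c i))
    ≡⟨ sum-cong-≗ (λ i → sym (∑-δ (c i) w)) ⟩
  sum (λ i → sum (λ a → δ (c i) a * w a))
    ≡⟨ ∑-comm (λ i a → δ (c i) a * w a) ⟩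
  sum (λ a → sum (λ i → δ (c i) a * w a))
    ≡⟨ sum-cong-≗ (λ a → sym (*-distribʳ-sum (w a) (λ i → δ (c i) a))) ⟩
  sum (λ a → sum (λ i → δ (c i) a) * w a) ∎
  where open ≡-Reasoning

∑-update : ∀ {n} (f g : Fin n → ℕ) s → (∀ i → i ≢ s → f i ≡ g i) → sum f + g s ≡ sum g + f s
∑-update {suc n} f g s f≗g = begin
  sum f + g s
    ≡⟨ cong (_+ g s) (sum-remove {i = s} f) ⟩
  f s + sum (f ∘ punchIn s) + g s
    ≡⟨ cong (λ z → f s + z + g s) (sum-cong-≗ (λ j → f≗g _ (punchInᵢ≢i s j))) ⟩
  f s + sum (g ∘ punchIn s) + g s
    ≡⟨ swap-outer (f s) _ (g s) ⟩
  g s + sum (g ∘ punchIn s) + f s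
    ≡⟨ cong (_+ f s) (sym (sum-remove {i = s} g)) ⟩
  sum g + f s ∎
  where
  open ≡-Reasoning
  swap-outer : ∀ x y z → x + y + z ≡ z + y + x
  swap-outer = solve-∀

classSize≡∑δ : ∀ G {k} (c : Colouring G k) b → classSize G c b ≡ sum (λ v → δ (c v) b)
classSize≡∑δ G c b = go (λ v → v)
  where
  go : ∀ {m} (g : Fin m → Fin (size G)) →
       length (filter (λ v → c v Fin.≟ b) (tabulate g)) ≡ sum (λ v → δ (c (g v)) b)
  go {zero}  g = refl
  go {suc m} g with does (c (g zero) Fin.≟ b)
  ... | true  = cong suc (go (g ∘ suc))
  ... | false = go (g ∘ suc)

classSize-cong : ∀ G {k} {c d : Colouring G k} → (∀ u → c u ≡ d u) → ∀ b →
  classSize G c b ≡ classSize G d b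
classSize-cong G {c = c} {d} c≗d b =
  trans (classSize≡∑δ G c b)
        (trans (sum-cong-≗ (λ u → cong (λ a → δ a b) (c≗d u))) (sym (classSize≡∑δ G d b)))

tally : ∀ {k} → (ℕ → Fin k) → ℕ → Fin k → ℕ
tally f n b = sum (λ (j : Fin n) → δ (f (toℕ j)) b)

quotRem-combine : ∀ {n k} (i : Fin n) (j : Fin k) → Fin.quotRem {n} k (combine i j) ≡ (j , i)
quotRem-combine i j = cong swap (remQuot-combine i j)

module Corona (G H : Graph) where

  private
    n = size G
    h = size H

  old : Fin n → Fin (size (G ∘G H))
  old u = u ↑ˡ (n * h)

  new : Fin n → Fin h → Fin (size (G ∘G H))
  new i j = n ↑ʳ combine {n} {h} i j

  adj-old-old : ∀ u v → adj (G ∘G H) (old u) (old v) ≡ adj G u v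
  adj-old-old u v rewrite splitAt-↑ˡ n u (n * h) | splitAt-↑ˡ n v (n * h) = refl

  adj-old-new : ∀ u i j → adj (G ∘G H) (old u) (new i j) ≡ ⌊ u Fin.≟ i ⌋
  adj-old-new u i j rewrite splitAt-↑ˡ n u (n * h) | splitAt-↑ʳ n (n * h) (combine {n} {h} i j)
                          | quotRem-combine {n} {h} i j = refl

  adj-new-old : ∀ i j u → adj (G ∘G H) (new i j) (old u) ≡ ⌊ u Fin.≟ i ⌋
  adj-new-old i j u rewrite splitAt-↑ˡ n u (n * h) | splitAt-↑ʳ n (n * h) (combine {n} {h} i j)
                          | quotRem-combine {n} {h} i j = refl

  adj-new-new : ∀ i j i′ j′ → adj (G ∘G H) (new i j) (new i′ j′) ≡ ⌊ i Fin.≟ i′ ⌋ ∧ adj H j j′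
  adj-new-new i j i′ j′ rewrite splitAt-↑ʳ n (n * h) (combine {n} {h} i j)
                              | splitAt-↑ʳ n (n * h) (combine {n} {h} i′ j′)
                              | quotRem-combine {n} {h} i j | quotRem-combine {n} {h} i′ j′ = refl

  data View : Fin (size (G ∘G H)) → Set where
    old-view : ∀ u → View (old u)
    new-view : ∀ i j → View (new i j)

  view : ∀ x → View x
  view x with splitAt n x in eq
  ... | inj₁ u = subst View (trans (cong (Fin.join n (n * h)) (sym eq)) (join-splitAt n (n * h) x)) (old-view u)
  ... | inj₂ q = subst View e (new-view (proj₁ (remQuot {n} h q)) (proj₂ (remQuot {n} h q)))
    where
    e : new (proj₁ (remQuot {n} h q)) (proj₂ (remQuot {n} h q)) ≡ x
    e = trans (cong (n ↑ʳ_) (combine-remQuot {n} h q))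
              (trans (cong (Fin.join n (n * h)) (sym eq)) (join-splitAt n (n * h) x))

  extend : ∀ {k} → (Fin n → Fin k) → (Fin n → Fin h → Fin k) → Colouring (G ∘G H) k
  extend c f x = [ c , (λ q → f (proj₁ (remQuot {n} h q)) (proj₂ (remQuot {n} h q))) ]′ (splitAt n x)

  extend-old : ∀ {k} (c : Fin n → Fin k) f u → extend c f (old u) ≡ c u
  extend-old c f u rewrite splitAt-↑ˡ n u (n * h) = refl

  extend-new : ∀ {k} (c : Fin n → Fin k) f i j → extend c f (new i j) ≡ f i j
  extend-new c f i j rewrite splitAt-↑ʳ n (n * h) (combine {n} {h} i j) | quotRem-combine {n} {h} i j = refl

  classSize-corona : ∀ {k} (c : Colouring (G ∘G H) k) b →
    classSize (G ∘G H) c b ≡ classSize G (c ∘ old) b + sum (λ i → sum (λ j → δ (c (new i j)) b))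
  classSize-corona c b = begin
    classSize (G ∘G H) c b
      ≡⟨ classSize≡∑δ (G ∘G H) c b ⟩
    sum (λ x → δ (c x) b)
      ≡⟨ ∑-splitAt n (n * h) _ ⟩
    sum (λ u → δ (c (old u)) b) + sum (λ q → δ (c (n ↑ʳ q)) b)
      ≡⟨ cong₂ _+_ (sym (classSize≡∑δ G (c ∘ old) b)) (∑-combine n h _) ⟩
    classSize G (c ∘ old) b + sum (λ i → sum (λ j → δ (c (new i j)) b)) ∎
    where open ≡-Reasoning

adj-path⇒consecutive : ∀ {m} (j j′ : Fin m) → adj (P m) j j′ ≡ true →
  toℕ j′ ≡ suc (toℕ j) ⊎ toℕ j ≡ suc (toℕ j′)
adj-path⇒consecutive j j′ e with suc (toℕ j) ≡ᵇ toℕ j′ in e₁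
... | true  = inj₁ (sym (≡ᵇ⇒≡ (suc (toℕ j)) (toℕ j′) (Equivalence.from T-≡ e₁)))
... | false = inj₂ (sym (≡ᵇ⇒≡ (suc (toℕ j′)) (toℕ j) (Equivalence.from T-≡ e)))

consecutive⇒adj-path : ∀ {m} (j j′ : Fin m) → toℕ j′ ≡ suc (toℕ j) → adj (P m) j j′ ≡ true
consecutive⇒adj-path j j′ j′≡1+j rewrite j′≡1+j =
  cong (_∨ (suc (suc (toℕ j)) ≡ᵇ toℕ j)) (Equivalence.to T-≡ (≡⇒≡ᵇ (suc (toℕ j)) (suc (toℕ j)) refl))

module PathCorona (G : Graph) (m : ℕ) where
  open Corona G (P m) public

  private
    n = size G

  proper-extend : ∀ {k} (c : Fin n → Fin k) (ρ : Fin n → ℕ → Fin k) → Proper G c →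
    (∀ i j → ρ i j ≢ c i) → (∀ i j → ρ i j ≢ ρ i (suc j)) →
    Proper (G ∘G P m) (extend c (λ i j → ρ i (toℕ j)))
  proper-extend c ρ c-proper avoid step x y e with view x | view y
  ... | old-view u | old-view v
    rewrite extend-old c (λ i j → ρ i (toℕ j)) u | extend-old c (λ i j → ρ i (toℕ j)) v =
    c-proper u v (trans (sym (adj-old-old u v)) e)
  ... | old-view u | new-view i j
    rewrite extend-old c (λ i j → ρ i (toℕ j)) u | extend-new c (λ i j → ρ i (toℕ j)) i j
    with ⌊≟⌋⇒≡ (trans (sym (adj-old-new u i j)) e)
  ... | refl = λ q → avoid u (toℕ j) (sym q)
  proper-extend c ρ c-proper avoid step x y e | new-view i j | old-view u
    rewrite extend-old c (λ i j → ρ i (toℕ j)) u | extend-new c (λ i j → ρ i (toℕ j)) i j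
    with ⌊≟⌋⇒≡ (trans (sym (adj-new-old i j u)) e)
  ... | refl = avoid u (toℕ j)
  proper-extend c ρ c-proper avoid step x y e | new-view i j | new-view i′ j′
    rewrite extend-new c (λ i j → ρ i (toℕ j)) i j | extend-new c (λ i j → ρ i (toℕ j)) i′ j′
    with trans (sym (adj-new-new i j i′ j′)) e
  ... | e′ with ⌊≟⌋⇒≡ (∧-conicalˡ ⌊ i Fin.≟ i′ ⌋ _ e′)
             | adj-path⇒consecutive j j′ (∧-conicalʳ ⌊ i Fin.≟ i′ ⌋ _ e′)
  ... | refl | inj₁ j′≡1+j = subst (λ z → ρ i (toℕ j) ≢ ρ i z) (sym j′≡1+j) (step i (toℕ j))
  ... | refl | inj₂ j≡1+j′ =
    λ q → subst (λ z → ρ i (toℕ j′) ≢ ρ i z) (sym j≡1+j′) (step i (toℕ j′)) (sym q)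

  classSize-extend : ∀ {k} (c : Fin n → Fin k) (ρ : Fin n → ℕ → Fin k) b →
    classSize (G ∘G P m) (extend c (λ i j → ρ i (toℕ j))) b ≡ classSize G c b + sum (λ i → tally (ρ i) m b)
  classSize-extend c ρ b =
    trans (classSize-corona (extend c (λ i j → ρ i (toℕ j))) b)
      (cong₂ _+_ (classSize-cong G (extend-old c (λ i j → ρ i (toℕ j))) b)
                 (sum-cong-≗ λ i → sum-cong-≗ λ j →
                    cong (λ a → δ a b) (extend-new c (λ i j → ρ i (toℕ j)) i j)))

-- Lower bounds

module Triangle (G : Graph) (m : ℕ) (u : Fin (size G)) where
  open Corona G (P (2 + m))

  triangle : Fin 3 → Fin (size (G ∘G P (2 + m)))
  triangle zero             = old u
  triangle (suc zero)       = new u zero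
  triangle (suc (suc zero)) = new u (suc zero)

  triangle-edge : ∀ i i′ → i Fin.< i′ → adj (G ∘G P (2 + m)) (triangle i) (triangle i′) ≡ true
  triangle-edge zero (suc zero) _ = trans (adj-old-new u u zero) (⌊≟⌋-refl u)
  triangle-edge zero (suc (suc zero)) _ = trans (adj-old-new u u (suc zero)) (⌊≟⌋-refl u)
  triangle-edge (suc zero) (suc (suc zero)) _ =
    trans (adj-new-new u zero u (suc zero)) (cong (_∧ true) (⌊≟⌋-refl u))
  triangle-edge (suc zero) (suc zero) (s≤s ())
  triangle-edge (suc (suc zero)) (suc (suc zero)) (s≤s (s≤s ()))
  triangle-edge (suc (suc zero)) (suc zero) (s≤s ())
  triangle-edge i zero ()

no-proper-colouring-below-3 : ∀ G m → Fin (size G) → ∀ {j} → j < 3 →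
  (c : Colouring (G ∘G P (2 + m)) j) → ¬ Proper (G ∘G P (2 + m)) c
no-proper-colouring-below-3 G m u j<3 c c-proper with pigeonhole j<3 (c ∘ triangle)
  where open Triangle G m u
... | i , i′ , i<i′ , same = c-proper _ _ (triangle-edge i i′ i<i′) same
  where open Triangle G m u

δ-three : ∀ (x y p b : Fin 3) → x ≢ p → y ≢ p → x ≢ y → δ x b + δ y b + δ p b ≡ 1
δ-three = from-yes (all? {3} λ x → all? {3} λ y → all? {3} λ p → all? {3} λ b →
  ¬? (x Fin.≟ p) →-dec ¬? (y Fin.≟ p) →-dec ¬? (x Fin.≟ y) →-dec (δ x b + δ y b + δ p b ℕ.≟ 1))

pattern-3-colouring-count : ∀ h (g : Fin (h * 2) → Fin 3) p b → (∀ j → g j ≢ p) →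
  (∀ j j′ → toℕ j′ ≡ suc (toℕ j) → g j ≢ g j′) → sum (λ j → δ (g j) b) + h * δ p b ≡ h
pattern-3-colouring-count zero    g p b avoid step = refl
pattern-3-colouring-count (suc h) g p b avoid step =
  trans (regroup (δ (g zero) b) (δ (g (suc zero)) b) (δ p b) (sum (λ j → δ (g (suc (suc j))) b)) (h * δ p b))
        (cong₂ _+_ (δ-three (g zero) (g (suc zero)) p b (avoid zero) (avoid (suc zero)) (step zero (suc zero) refl))
                   (pattern-3-colouring-count h (λ j → g (suc (suc j))) p b (λ j → avoid (suc (suc j)))
                      (λ j j′ e → step (suc (suc j)) (suc (suc j′)) (cong (λ z → suc (suc z)) e))))
  where
  regroup : ∀ x y z r s → x + (y + r) + (z + s) ≡ x + y + z + (r + s)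
  regroup = solve-∀

Balanced : (G : Graph) {k : ℕ} → Colouring G k → Set
Balanced G c = ∀ a b → classSize G c a ≡ classSize G c b

module EvenPathCorona (G : Graph) (h : ℕ) where
  open Corona G (P (h * 2))

  classSize-even-corona : (c : Colouring (G ∘G P (h * 2)) 3) → Proper (G ∘G P (h * 2)) c → ∀ b →
    classSize (G ∘G P (h * 2)) c b + h * classSize G (c ∘ old) b ≡ classSize G (c ∘ old) b + size G * h
  classSize-even-corona c c-proper b = begin
    classSize (G ∘G P (h * 2)) c b + h * x
      ≡⟨ cong₂ _+_ (classSize-corona c b) (cong (h *_) (classSize≡∑δ G (c ∘ old) b)) ⟩
    x + sum copy + h * sum (λ i → δ (c (old i)) b)
      ≡⟨ +-assoc x _ _ ⟩
    x + (sum copy + h * sum (λ i → δ (c (old i)) b))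
      ≡⟨ cong (λ z → x + (sum copy + z)) (*-distribˡ-sum h (λ i → δ (c (old i)) b)) ⟩
    x + (sum copy + sum (λ i → h * δ (c (old i)) b))
      ≡⟨ cong (x +_) (sym (∑-distrib-+ copy (λ i → h * δ (c (old i)) b))) ⟩
    x + sum (λ i → copy i + h * δ (c (old i)) b)
      ≡⟨ cong (x +_) (sum-cong-≗ per-copy) ⟩
    x + sum {size G} (λ _ → h)
      ≡⟨ cong (x +_) (∑-const (size G) h) ⟩
    x + size G * h ∎
    where
    open ≡-Reasoning
    x = classSize G (c ∘ old) b
    copy : Fin (size G) → ℕ
    copy i = sum (λ j → δ (c (new i j)) b)
    per-copy : ∀ i → copy i + h * δ (c (old i)) b ≡ h
    per-copy i = pattern-3-colouring-count h (c ∘ new i) (c (old i)) b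
      (λ j q → c-proper (old i) (new i j) (trans (adj-old-new i i j) (⌊≟⌋-refl i)) (sym q))
      (λ j j′ e → c-proper (new i j) (new i j′)
        (trans (adj-new-new i j i j′) (cong₂ _∧_ (⌊≟⌋-refl i) (consecutive⇒adj-path j j′ e))))

-- The equation says B − A = (2 + h′)(X − Y).
scaled-difference-≤ : ∀ h′ {A B X Y} → A + (3 + h′) * X + Y ≡ B + (3 + h′) * Y + X → B ≤ suc A → X ≤ Y
scaled-difference-≤ h′ {A} {B} {X} {Y} e B≤1+A with ≤-<-connex X Y
... | inj₁ X≤Y = X≤Y
... | inj₂ Y<X with m≤n⇒∃[o]m+o≡n Y<X
... | d , refl = ⊥-elim (m+n≮m A surplus (≤-pred (≤-trans (≤-reflexive B≡2+A+surplus) B≤1+A)))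
  where
  surplus = d + d + h′ * suc d
  common = (3 + h′) * Y + Y + suc d
  lhs : ∀ A Y d h′ →
    A + (3 + h′) * suc (Y + d) + Y ≡ suc (suc (A + (d + d + h′ * suc d))) + ((3 + h′) * Y + Y + suc d)
  lhs = solve-∀
  rhs : ∀ B Y d h′ → B + (3 + h′) * Y + suc (Y + d) ≡ B + ((3 + h′) * Y + Y + suc d)
  rhs = solve-∀
  B≡2+A+surplus : suc (suc (A + surplus)) ≡ B
  B≡2+A+surplus = +-cancelʳ-≡ common _ _ (trans (sym (lhs A Y d h′)) (trans e (rhs B Y d h′)))

balanced-restriction : ∀ h′ G (c : Colouring (G ∘G P ((3 + h′) * 2)) 3) →
  Proper (G ∘G P ((3 + h′) * 2)) c → Equitable (G ∘G P ((3 + h′) * 2)) c →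
  Proper G (c ∘ Corona.old G (P ((3 + h′) * 2))) × Balanced G (c ∘ Corona.old G (P ((3 + h′) * 2)))
balanced-restriction h′ G c c-proper c-equitable =
  (λ u v e → c-proper (old u) (old v) (trans (adj-old-old u v) e)) ,
  (λ a b → ≤-antisym (restricted-≤ a b) (restricted-≤ b a))
  where
  open Corona G (P ((3 + h′) * 2))
  open EvenPathCorona G (3 + h′)
  restricted-≤ : ∀ a b → classSize G (c ∘ old) a ≤ classSize G (c ∘ old) b
  restricted-≤ a b =
    scaled-difference-≤ h′ (cross (x′ a) (x′ b) (x a) (x b) (size G * (3 + h′))
                             (classSize-even-corona c c-proper a) (classSize-even-corona c c-proper b))
                      (c-equitable b a)
    where
    x′ x : Fin 3 → ℕ
    x′ = classSize (G ∘G P ((3 + h′) * 2)) c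
    x  = classSize G (c ∘ old)
    cross : ∀ A B X Y Z → A + (3 + h′) * X ≡ X + Z → B + (3 + h′) * Y ≡ Y + Z →
            A + (3 + h′) * X + Y ≡ B + (3 + h′) * Y + X
    cross A B X Y Z eA eB = begin
      A + (3 + h′) * X + Y   ≡⟨ cong (_+ Y) eA ⟩
      X + Z + Y              ≡⟨ swap-ends X Z Y ⟩
      Y + Z + X              ≡⟨ cong (_+ X) (sym eB) ⟩
      B + (3 + h′) * Y + X ∎
      where
      open ≡-Reasoning
      swap-ends : ∀ X Z Y → X + Z + Y ≡ Y + Z + X
      swap-ends = solve-∀

K1-unbalanced : (c : Colouring K1 3) → ¬ Balanced K1 c
K1-unbalanced c balanced = distinct (c zero)
  (trans (sym (classSize≡∑δ K1 c (c zero)))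
         (trans (balanced (c zero) (other (c zero))) (classSize≡∑δ K1 c (other (c zero)))))
  where
  other : Fin 3 → Fin 3
  other zero    = suc zero
  other (suc _) = zero
  distinct : ∀ a → δ a a + 0 ≢ δ a (other a) + 0
  distinct zero             ()
  distinct (suc zero)       ()
  distinct (suc (suc zero)) ()

no-balanced-3-colouring : ∀ h′ l (c : Colouring (K1 ∘^ l ⟨ P ((3 + h′) * 2) ⟩) 3) →
  Proper (K1 ∘^ l ⟨ P ((3 + h′) * 2) ⟩) c → ¬ Balanced (K1 ∘^ l ⟨ P ((3 + h′) * 2) ⟩) c
no-balanced-3-colouring h′ zero    c _        balanced = K1-unbalanced c balanced
no-balanced-3-colouring h′ (suc l) c c-proper balanced =
  let (restriction-proper , restriction-balanced) =
        balanced-restriction h′ _ c c-proper (λ a b → m≤n⇒m≤1+n (≤-reflexive (balanced a b)))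
  in no-balanced-3-colouring h′ l _ restriction-proper restriction-balanced

no-equitable-3-colouring : ∀ h′ l → ¬ EqColourable (K1 ∘^ suc l ⟨ P ((3 + h′) * 2) ⟩) 3
no-equitable-3-colouring h′ l (c , c-proper , c-equitable) =
  let (restriction-proper , restriction-balanced) = balanced-restriction h′ _ c c-proper c-equitable
  in no-balanced-3-colouring h′ l _ restriction-proper restriction-balanced

-- Eventually periodic path colourings

repeatAfter : List A → List⁺ A → ℕ → A
repeatAfter (x ∷ xs) B        zero    = x
repeatAfter (x ∷ xs) B        (suc j) = repeatAfter xs B j
repeatAfter []       (b ∷ bs) zero    = b
repeatAfter []       (b ∷ bs) (suc j) = repeatAfter bs (b ∷ bs) j

repeatAfter-all : ∀ {P : Pred A ℓ} {xs} {B} → All P xs → All P (toList B) → ∀ j → P (repeatAfter xs B j)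
repeatAfter-all (px ∷ pxs) pB        zero    = px
repeatAfter-all (px ∷ pxs) pB        (suc j) = repeatAfter-all pxs pB j
repeatAfter-all []         (pb ∷ pB) zero    = pb
repeatAfter-all []         (pb ∷ pB) (suc j) = repeatAfter-all pB (pb ∷ pB) j

repeatAfter-linked : ∀ {R : Rel A ℓ} xs B → Linked R (xs ∷ʳ List⁺.head B) →
  Linked R (toList B ∷ʳ List⁺.head B) → ∀ j → R (repeatAfter xs B j) (repeatAfter xs B (suc j))
repeatAfter-linked (x ∷ [])     B        Rxs RB zero    = Linked.head Rxs
repeatAfter-linked (x ∷ y ∷ xs) B        Rxs RB zero    = Linked.head Rxs
repeatAfter-linked (x ∷ xs)     B        Rxs RB (suc j) = repeatAfter-linked xs B (Linked.tail Rxs) RB j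
repeatAfter-linked []           (b ∷ []) Rxs RB zero    = Linked.head RB
repeatAfter-linked []           (b ∷ c ∷ bs) Rxs RB zero = Linked.head RB
repeatAfter-linked []           (b ∷ bs) Rxs RB (suc j) = repeatAfter-linked bs (b ∷ bs) (Linked.tail RB) RB j

occ : ∀ {k} → List (Fin k) → Fin k → ℕ
occ []       b = 0
occ (x ∷ xs) b = δ x b + occ xs b

tally-prefix : ∀ {k} (xs : List (Fin k)) B n b →
  tally (repeatAfter xs B) (length xs + n) b ≡ occ xs b + tally (repeatAfter [] B) n b
tally-prefix []       B n b = refl
tally-prefix (x ∷ xs) B n b = trans (cong (δ x b +_) (tally-prefix xs B n b)) (sym (+-assoc (δ x b) _ _))

tally-period : ∀ {k} (B : List⁺ (Fin k)) n b →
  tally (repeatAfter [] B) (List⁺.length B + n) b ≡ occ (toList B) b + tally (repeatAfter [] B) n b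
tally-period (x ∷ xs) n b = trans (cong (δ x b +_) (tally-prefix xs (x ∷ xs) n b)) (sym (+-assoc (δ x b) _ _))

tally-repeatAfter : ∀ {k} (xs : List (Fin k)) B t b →
  tally (repeatAfter xs B) (length xs + t * List⁺.length B) b ≡ occ xs b + t * occ (toList B) b
tally-repeatAfter xs B t b = trans (tally-prefix xs B (t * List⁺.length B) b) (cong (occ xs b +_) (periods t))
  where
  periods : ∀ t → tally (repeatAfter [] B) (t * List⁺.length B) b ≡ t * occ (toList B) b
  periods zero    = refl
  periods (suc t) = trans (tally-period B (t * List⁺.length B) b) (cong (occ (toList B) b +_) (periods t))

record Pattern (k : ℕ) : Set where
  constructor _then-repeat_
  field
    prefix : List (Fin k)
    period : List⁺ (Fin k)
open Pattern public

paint : ∀ {k} → Pattern k → ℕ → Fin k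
paint P = repeatAfter (prefix P) (period P)

prefix-weight period-weight : ∀ {k} → Pattern k → Fin k → ℕ
prefix-weight P = occ (prefix P)
period-weight P = occ (toList (period P))

weight : ∀ {k} → Pattern k → ℕ → Fin k → ℕ
weight P t b = prefix-weight P b + t * period-weight P b

record Valid {k} (p q : ℕ) (a : Fin k) (P : Pattern k) : Set where
  field
    prefix-length : length (prefix P) ≡ p
    period-length : List⁺.length (period P) ≡ q
    prefix-avoids : All (_≢ a) (prefix P)
    period-avoids : All (_≢ a) (toList (period P))
    prefix-linked : Linked _≢_ (prefix P ∷ʳ List⁺.head (period P))
    period-linked : Linked _≢_ (toList (period P) ∷ʳ List⁺.head (period P))

valid? : ∀ {k} p q (a : Fin k) P → Dec (Valid p q a P)
valid? p q a P = map′ (λ (l₀ , l₁ , a₀ , a₁ , k₀ , k₁) → record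
                         { prefix-length = l₀ ; period-length = l₁ ; prefix-avoids = a₀ ; period-avoids = a₁
                         ; prefix-linked = k₀ ; period-linked = k₁ })
                      (λ v → let open Valid v in
                         prefix-length , period-length , prefix-avoids , period-avoids , prefix-linked , period-linked)
  (length (prefix P) ℕ.≟ p ×-dec List⁺.length (period P) ℕ.≟ q ×-dec
   All.all? (λ x → ¬? (x Fin.≟ a)) (prefix P) ×-dec All.all? (λ x → ¬? (x Fin.≟ a)) (toList (period P)) ×-dec
   linked? (λ x y → ¬? (x Fin.≟ y)) _ ×-dec linked? (λ x y → ¬? (x Fin.≟ y)) _)

module _ {k p q} {a : Fin k} {P : Pattern k} (valid : Valid p q a P) where
  open Valid valid

  paint-avoids : ∀ j → paint P j ≢ a
  paint-avoids = repeatAfter-all prefix-avoids period-avoids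

  paint-proper : ∀ j → paint P j ≢ paint P (suc j)
  paint-proper = repeatAfter-linked (prefix P) (period P) prefix-linked period-linked

  tally-paint : ∀ t b → tally (paint P) (p + t * q) b ≡ weight P t b
  tally-paint t b rewrite sym prefix-length | sym period-length = tally-repeatAfter (prefix P) (period P) t b

module Extension (G : Graph) (m : ℕ) {k} (c : Colouring G k) (s : Fin (size G))
            (ρ : Fin k → ℕ → Fin k) (σ : ℕ → Fin k) where
  open PathCorona G m

  path : Fin (size G) → ℕ → Fin k
  path i = if does (i Fin.≟ s) then σ else ρ (c i)

  path-special : path s ≡ σ
  path-special with s Fin.≟ s
  ... | yes _   = refl
  ... | no s≢s = ⊥-elim (s≢s refl)

  path-regular : ∀ i → i ≢ s → path i ≡ ρ (c i)
  path-regular i i≢s with i Fin.≟ s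
  ... | yes i≡s = ⊥-elim (i≢s i≡s)
  ... | no _    = refl

  extended : Colouring (G ∘G P m) k
  extended = extend c (λ i j → path i (toℕ j))

  extended-old : ∀ u → extended (old u) ≡ c u
  extended-old = extend-old c (λ i j → path i (toℕ j))

  extended-special : ∀ j → extended (new s j) ≡ σ (toℕ j)
  extended-special j = trans (extend-new c (λ i j → path i (toℕ j)) s j) (cong (λ π → π (toℕ j)) path-special)

  extended-proper : Proper G c → (∀ a j → ρ a j ≢ a) → (∀ a j → ρ a j ≢ ρ a (suc j)) →
    (∀ j → σ j ≢ c s) → (∀ j → σ j ≢ σ (suc j)) → Proper (G ∘G P m) extended
  extended-proper c-proper ρ-avoids ρ-proper σ-avoids σ-proper =
    proper-extend c path c-proper avoids proper
    where
    avoids : ∀ i j → path i j ≢ c i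
    avoids i j with i Fin.≟ s
    ... | yes refl = σ-avoids j
    ... | no _     = ρ-avoids (c i) j
    proper : ∀ i j → path i j ≢ path i (suc j)
    proper i j with i Fin.≟ s
    ... | yes _ = σ-proper j
    ... | no _  = ρ-proper (c i) j

  classSize-extended : ∀ b →
    classSize (G ∘G P m) extended b + tally (ρ (c s)) m b ≡
    classSize G c b + sum (λ a → classSize G c a * tally (ρ a) m b) + tally σ m b
  classSize-extended b = begin
    classSize (G ∘G P m) extended b + regular s
      ≡⟨ cong (_+ regular s) (classSize-extend c path b) ⟩
    classSize G c b + sum actual + regular s
      ≡⟨ +-assoc (classSize G c b) _ _ ⟩
    classSize G c b + (sum actual + regular s)
      ≡⟨ cong (classSize G c b +_)
              (∑-update actual regular s (λ i i≢s → cong (λ π → tally π m b) (path-regular i i≢s))) ⟩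
    classSize G c b + (sum regular + actual s)
      ≡⟨ sym (+-assoc (classSize G c b) _ _) ⟩
    classSize G c b + sum regular + actual s
      ≡⟨ cong₂ (λ y z → classSize G c b + y + z) by-colour (cong (λ π → tally π m b) path-special) ⟩
    classSize G c b + sum (λ a → classSize G c a * tally (ρ a) m b) + tally σ m b ∎
    where
    open ≡-Reasoning
    actual regular : Fin (size G) → ℕ
    actual i = tally (path i) m b
    regular i = tally (ρ (c i)) m b
    by-colour : sum regular ≡ sum (λ a → classSize G c a * tally (ρ a) m b)
    by-colour = trans (∑-by-colour c (λ a → tally (ρ a) m b))
                      (sum-cong-≗ (λ a → cong (_* tally (ρ a) m b) (sym (classSize≡∑δ G c a))))

-- Shapes of class-size vectors

record ConstantlyAbove {k} (f g : Fin k → ℕ) : Set where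
  constructor _,_
  field
    gap    : ℕ
    gap-eq : ∀ b → f b ≡ gap + g b

Shaped : ∀ {k} → (Fin k → ℕ) → ℕ → (Fin k → ℕ) → Set
Shaped x U e = ∀ b → x b ≡ U + e b

shaped-equitable : ∀ {k} {x e : Fin k → ℕ} {U} → Shaped x U e → (∀ b → e b ≤ 1) →
  ∀ a b → x a ≤ suc (x b)
shaped-equitable {U = U} x≡U+e e≤1 a b rewrite x≡U+e a | x≡U+e b =
  ≤-trans (+-monoʳ-≤ U (e≤1 a)) (≤-trans (≤-reflexive (+-comm U 1)) (ℕ.s≤s (m≤m+n U _)))

ShapeTransition : ∀ {k} → (Fin k → ℕ) → (Fin k → Fin k → ℕ) → (Fin k → ℕ) → Fin k → (Fin k → ℕ) →
  Set
ShapeTransition e W S sc e′ = ConstantlyAbove (λ b → e b + sum (λ a → e a * W a b) + S b) (λ b → e′ b + W sc b)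

shape-step : ∀ {k} {x x′ : Fin k → ℕ} {W : Fin k → Fin k → ℕ} {S : Fin k → ℕ} {sc : Fin k} {m U : ℕ}
  {e e′ : Fin k → ℕ} →
  (∀ b → x′ b + W sc b ≡ x b + sum (λ a → x a * W a b) + S b) →
  Shaped x U e → (∀ b → U * sum (λ a → W a b) ≡ U * m) →
  (transition : ShapeTransition e W S sc e′) →
  Shaped x′ (U + U * m + ConstantlyAbove.gap transition) e′
shape-step {x = x} {x′} {W} {S} {sc} {m} {U} {e} {e′} count x-shaped balanced (v , above) b =
  +-cancelʳ-≡ (W sc b) (x′ b) _ (begin
    x′ b + W sc b
      ≡⟨ count b ⟩
    x b + sum (λ a → x a * W a b) + S b
      ≡⟨ cong₂ (λ y z → y + z + S b) (x-shaped b) (sum-cong-≗ (λ a → cong (_* W a b) (x-shaped a))) ⟩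
    U + e b + sum (λ a → (U + e a) * W a b) + S b
      ≡⟨ cong (λ z → U + e b + z + S b) split ⟩
    U + e b + (U * m + sum (λ a → e a * W a b)) + S b
      ≡⟨ regroup U (e b) (U * m) (sum (λ a → e a * W a b)) (S b) ⟩
    U + U * m + (e b + sum (λ a → e a * W a b) + S b)
      ≡⟨ cong (U + U * m +_) (above b) ⟩
    U + U * m + (v + (e′ b + W sc b))
      ≡⟨ regroup′ (U + U * m) v (e′ b) (W sc b) ⟩
    U + U * m + v + e′ b + W sc b                              ∎)
  where
  open ≡-Reasoning
  split : sum (λ a → (U + e a) * W a b) ≡ U * m + sum (λ a → e a * W a b)
  split = begin
    sum (λ a → (U + e a) * W a b)
      ≡⟨ sum-cong-≗ (λ a → *-distribʳ-+′ (W a b) U (e a)) ⟩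
    sum (λ a → U * W a b + e a * W a b)
      ≡⟨ ∑-distrib-+ (λ a → U * W a b) (λ a → e a * W a b) ⟩
    sum (λ a → U * W a b) + sum (λ a → e a * W a b)
      ≡⟨ cong (_+ sum (λ a → e a * W a b)) (sym (*-distribˡ-sum U (λ a → W a b))) ⟩
    U * sum (λ a → W a b) + sum (λ a → e a * W a b)
      ≡⟨ cong (_+ sum (λ a → e a * W a b)) (balanced b) ⟩
    U * m + sum (λ a → e a * W a b) ∎
    where *-distribʳ-+′ : ∀ w u y → (u + y) * w ≡ u * w + y * w
          *-distribʳ-+′ = solve-∀
  regroup : ∀ u y z s r → u + y + (z + s) + r ≡ u + z + (y + s + r)
  regroup = solve-∀
  regroup′ : ∀ u v y w → u + (v + (y + w)) ≡ u + v + y + w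
  regroup′ = solve-∀

-- Level l + 1 is coloured by painting the pendant paths of level l: with `root` at level 0, with
-- `rule₁` at level 1 and with `rule` afterwards, except that from level 1 on the path of the first
-- vertex of the root's path (whose colour is `paint root 0`) is painted with `special₁`, resp.
-- `special`. At level 2 + l the class sizes have the shape `shape (next^l start)`.
record Scheme (k : ℕ) : Set where
  field
    p q              : ℕ
    {{p-nonzero}}    : NonZero p
    root-colour      : Fin k
    root             : Pattern k
    rule₁ rule       : Fin k → Pattern k
    special₁ special : Pattern k
    states           : ℕ
    shape            : Fin states → Fin k → ℕ
    next             : Fin states → Fin states
    start            : Fin states
    root-valid       : Valid p q root-colour root
    rule₁-valid      : ∀ a → Valid p q a (rule₁ a)
    rule-valid       : ∀ a → Valid p q a (rule a)
    special₁-valid   : Valid p q (paint root 0) special₁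
    special-valid    : Valid p q (paint root 0) special
    shape-zero-one   : ∀ σ b → shape σ b ≤ 1

record Design (k t : ℕ) : Set where
  field
    scheme : Scheme k
  open Scheme scheme
  field
    rule-balanced : ∀ b → sum (λ a → weight (rule a) t b) ≡ p + t * q
    reaches-start : ShapeTransition (λ b → δ root-colour b + prefix-weight root b + t * period-weight root b)
                     (λ a → weight (rule₁ a) t) (weight special₁ t) (paint root 0) (shape start)
    closed        : ∀ σ → ShapeTransition (shape σ) (λ a → weight (rule a) t) (weight special t) (paint root 0)
                            (shape (next σ))

module Construction {k t} (D : Design k t) where
  open Design D
  open Scheme scheme

  m : ℕ
  m = p + t * q

  Gr : ℕ → Graph
  Gr l = K1 ∘^ l ⟨ P m ⟩

  first-position : Fin m
  first-position = Fin.fromℕ< (<-≤-trans (ℕ.>-nonZero⁻¹ p) (m≤m+n p (t * q)))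

  root-path-head : ∀ l → Fin (size (Gr (suc l)))
  root-path-head zero    = Corona.new K1 (P m) zero first-position
  root-path-head (suc l) = Corona.old (Gr (suc l)) (P m) (root-path-head l)

  -- At level 0 the root is the only vertex, and it is the exceptional one.
  regular-pattern : ℕ → Fin k → Pattern k
  regular-pattern (suc (suc l)) = rule
  regular-pattern _             = rule₁

  exceptional-pattern : ℕ → Pattern k
  exceptional-pattern zero          = root
  exceptional-pattern (suc zero)    = special₁
  exceptional-pattern (suc (suc l)) = special

  exceptional-vertex : ∀ l → Fin (size (Gr l))
  exceptional-vertex zero    = zero
  exceptional-vertex (suc l) = root-path-head l

  exceptional-colour : ℕ → Fin k
  exceptional-colour zero    = root-colour
  exceptional-colour (suc l) = paint root 0

  colouring : ∀ l → Colouring (Gr l) k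
  colouring zero    _ = root-colour
  colouring (suc l) = Extension.extended (Gr l) m (colouring l) (exceptional-vertex l)
                        (paint ∘ regular-pattern l) (paint (exceptional-pattern l))

  module Step (l : ℕ) = Extension (Gr l) m (colouring l) (exceptional-vertex l)
                          (paint ∘ regular-pattern l) (paint (exceptional-pattern l))

  colouring-root-path-head : ∀ l → colouring (suc l) (root-path-head l) ≡ paint root 0
  colouring-root-path-head zero    = trans (Step.extended-special 0 first-position) (cong (paint root) (toℕ-fromℕ< _))
  colouring-root-path-head (suc l) = trans (Step.extended-old (suc l) (root-path-head l)) (colouring-root-path-head l)

  colouring-exceptional : ∀ l → colouring l (exceptional-vertex l) ≡ exceptional-colour l
  colouring-exceptional zero    = refl
  colouring-exceptional (suc l) = colouring-root-path-head l

  regular-valid : ∀ l a → Valid p q a (regular-pattern l a)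
  regular-valid zero          = rule₁-valid
  regular-valid (suc zero)    = rule₁-valid
  regular-valid (suc (suc l)) = rule-valid

  exceptional-valid : ∀ l → Valid p q (exceptional-colour l) (exceptional-pattern l)
  exceptional-valid zero          = root-valid
  exceptional-valid (suc zero)    = special₁-valid
  exceptional-valid (suc (suc l)) = special-valid

  proper : ∀ l → Proper (Gr l) (colouring l)
  proper zero    u v ()
  proper (suc l) =
    Step.extended-proper l (proper l) (λ a → paint-avoids (regular-valid l a)) (λ a → paint-proper (regular-valid l a))
      (λ j → subst (paint (exceptional-pattern l) j ≢_) (sym (colouring-exceptional l))
                   (paint-avoids (exceptional-valid l) j))
    (paint-proper (exceptional-valid l))

  x : ℕ → Fin k → ℕ
  x l = classSize (Gr l) (colouring l)

  count : ∀ l b →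
    x (suc l) b + weight (regular-pattern l (exceptional-colour l)) t b ≡
    x l b + sum (λ a → x l a * weight (regular-pattern l a) t b) + weight (exceptional-pattern l) t b
  count l b = begin
    x (suc l) b + weight (regular-pattern l (exceptional-colour l)) t b
      ≡⟨ cong (x (suc l) b +_) (sym (trans (cong (λ a → tally (paint (regular-pattern l a)) m b) (colouring-exceptional l))
                                           (tally-paint (regular-valid l _) t b))) ⟩
    x (suc l) b + tally (paint (regular-pattern l (colouring l (exceptional-vertex l)))) m b
      ≡⟨ Step.classSize-extended l b ⟩
    x l b + sum (λ a → x l a * tally (paint (regular-pattern l a)) m b) + tally (paint (exceptional-pattern l)) m b
      ≡⟨ cong₂ (λ y z → x l b + y + z) (sum-cong-≗ (λ a → cong (x l a *_) (tally-paint (regular-valid l a) t b)))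
                                        (tally-paint (exceptional-valid l) t b) ⟩
    x l b + sum (λ a → x l a * weight (regular-pattern l a) t b) + weight (exceptional-pattern l) t b ∎
    where open ≡-Reasoning

  level-zero : Shaped (x 0) 0 (δ root-colour)
  level-zero b = trans (classSize≡∑δ K1 (colouring 0) b) (+-identityʳ (δ root-colour b))

  level-one-shape : Fin k → ℕ
  level-one-shape b = δ root-colour b + prefix-weight root b + t * period-weight root b

  level-one : Shaped (x 1) 0 level-one-shape
  level-one = shape-step {m = m} {U = 0} {e = δ root-colour} {e′ = level-one-shape}
                         (count 0) level-zero (λ b → refl) (0 , root-only)
    where
    root-only : ∀ b → δ root-colour b + sum (λ a → δ root-colour a * weight (rule₁ a) t b) + weight root t b ≡
                      level-one-shape b + weight (rule₁ root-colour) t b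
    root-only b =
      trans (cong (λ z → δ root-colour b + z + weight root t b) (∑-δ root-colour (λ a → weight (rule₁ a) t b)))
            (regroup (δ root-colour b) (weight (rule₁ root-colour) t b) (prefix-weight root b) (t * period-weight root b))
      where regroup : ∀ u v w z → u + v + (w + z) ≡ u + w + z + v
            regroup = solve-∀

  state : ℕ → Fin states
  state zero    = start
  state (suc l) = next (state l)

  invariant : ∀ l → Σ ℕ λ U → Shaped (x (2 + l)) U (shape (state l))
  invariant zero    = _ , shape-step {m = m} {U = 0} {e′ = shape start} (count 1) level-one (λ b → refl) reaches-start
  invariant (suc l) with invariant l
  ... | U , shaped = _ , shape-step {m = m} {U = U} {e = shape (state l)} {e′ = shape (state (suc l))}
                                    (count (2 + l)) shaped (λ b → cong (U *_) (rule-balanced b)) (closed (state l))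

  equitably-colourable : ∀ l → EqColourable (Gr (2 + l)) k
  equitably-colourable l =
    colouring (2 + l) , proper (2 + l) , shaped-equitable (proj₂ (invariant l)) (shape-zero-one (state l))

-- Families of path lengths

∑-affine : ∀ {k} t (f g : Fin k → ℕ) → sum (λ a → f a + t * g a) ≡ sum f + t * sum g
∑-affine t f g = trans (∑-distrib-+ f (λ a → t * g a)) (cong (sum f +_) (sym (*-distribˡ-sum t g)))

affine-transition : ∀ {k} {e₀ e₁ s₀ s₁ e′ : Fin k → ℕ} {L B : Fin k → Fin k → ℕ} {sc : Fin k} →
  ShapeTransition e₀ L s₀ sc e′ →
  ConstantlyAbove (λ b → e₁ b + sum (λ a → e₀ a * B a b + e₁ a * L a b) + s₁ b) (λ b → B sc b) →
  ConstantlyAbove (λ b → sum (λ a → e₁ a * B a b)) (λ _ → 0) →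
  ∀ t → ShapeTransition (λ b → e₀ b + t * e₁ b) (λ a b → L a b + t * B a b) (λ b → s₀ b + t * s₁ b) sc e′
affine-transition {e₀ = e₀} {e₁} {s₀} {s₁} {e′} {L} {B} {sc} (v₀ , constant) (v₁ , linear) (v₂ , quadratic) t =
  v₀ + t * v₁ + t * t * v₂ , λ b → begin
    (e₀ b + t * e₁ b) + sum (λ a → (e₀ a + t * e₁ a) * (L a b + t * B a b)) + (s₀ b + t * s₁ b)
      ≡⟨ cong (λ z → e₀ b + t * e₁ b + z + (s₀ b + t * s₁ b)) (expand b) ⟩
    (e₀ b + t * e₁ b) + (sum (X b) + t * (sum (Y b) + t * sum (Z b))) + (s₀ b + t * s₁ b)
      ≡⟨ collect (e₀ b) (e₁ b) (sum (X b)) (sum (Y b)) (sum (Z b)) (s₀ b) (s₁ b) t ⟩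
    (e₀ b + sum (X b) + s₀ b) + t * (e₁ b + sum (Y b) + s₁ b) + t * t * sum (Z b)
      ≡⟨ cong₂ (λ c₀ c₁ → c₀ + t * c₁ + t * t * sum (Z b)) (constant b) (linear b) ⟩
    (v₀ + (e′ b + L sc b)) + t * (v₁ + B sc b) + t * t * sum (Z b)
      ≡⟨ cong (λ c₂ → v₀ + (e′ b + L sc b) + t * (v₁ + B sc b) + t * t * c₂) (quadratic b) ⟩
    (v₀ + (e′ b + L sc b)) + t * (v₁ + B sc b) + t * t * (v₂ + 0)
      ≡⟨ distribute v₀ v₁ v₂ (e′ b) (L sc b) (B sc b) t ⟩
    v₀ + t * v₁ + t * t * v₂ + (e′ b + (L sc b + t * B sc b)) ∎
  where
  open ≡-Reasoning
  X Y Z : Fin _ → Fin _ → ℕ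
  X b a = e₀ a * L a b
  Y b a = e₀ a * B a b + e₁ a * L a b
  Z b a = e₁ a * B a b
  expand : ∀ b → sum (λ a → (e₀ a + t * e₁ a) * (L a b + t * B a b)) ≡ sum (X b) + t * (sum (Y b) + t * sum (Z b))
  expand b = begin
    sum (λ a → (e₀ a + t * e₁ a) * (L a b + t * B a b))
      ≡⟨ sum-cong-≗ (λ a → product (e₀ a) (e₁ a) (L a b) (B a b) t) ⟩
    sum (λ a → X b a + t * (Y b a + t * Z b a))
      ≡⟨ ∑-affine t (X b) (λ a → Y b a + t * Z b a) ⟩
    sum (X b) + t * sum (λ a → Y b a + t * Z b a)
      ≡⟨ cong (λ z → sum (X b) + t * z) (∑-affine t (Y b) (Z b)) ⟩
    sum (X b) + t * (sum (Y b) + t * sum (Z b)) ∎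
    where
    product : ∀ e₀ e₁ l β t → (e₀ + t * e₁) * (l + t * β) ≡ e₀ * l + t * (e₀ * β + e₁ * l + t * (e₁ * β))
    product = solve-∀
  collect : ∀ e₀ e₁ x y z s₀ s₁ t →
    e₀ + t * e₁ + (x + t * (y + t * z)) + (s₀ + t * s₁) ≡ e₀ + x + s₀ + t * (e₁ + y + s₁) + t * t * z
  collect = solve-∀
  distribute : ∀ v₀ v₁ v₂ e l β t →
    v₀ + (e + l) + t * (v₁ + β) + t * t * (v₂ + 0) ≡ v₀ + t * v₁ + t * t * v₂ + (e + (l + t * β))
  distribute = solve-∀

affine-transition-fixed : ∀ {k} {e s₀ s₁ e′ : Fin k → ℕ} {L B : Fin k → Fin k → ℕ} {sc : Fin k} →
  ShapeTransition e L s₀ sc e′ →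
  ConstantlyAbove (λ b → sum (λ a → e a * B a b) + s₁ b) (λ b → B sc b) →
  ∀ t → ShapeTransition e (λ a b → L a b + t * B a b) (λ b → s₀ b + t * s₁ b) sc e′
affine-transition-fixed {e = e} {s₀} {s₁} {e′} {L} {B} {sc} (v₀ , constant) (v₁ , linear) t =
  v₀ + t * v₁ , λ b → begin
    e b + sum (λ a → e a * (L a b + t * B a b)) + (s₀ b + t * s₁ b)
      ≡⟨ cong (λ z → e b + z + (s₀ b + t * s₁ b)) (expand b) ⟩
    e b + (sum (λ a → e a * L a b) + t * sum (λ a → e a * B a b)) + (s₀ b + t * s₁ b)
      ≡⟨ collect (e b) (sum (λ a → e a * L a b)) (sum (λ a → e a * B a b)) (s₀ b) (s₁ b) t ⟩
    (e b + sum (λ a → e a * L a b) + s₀ b) + t * (sum (λ a → e a * B a b) + s₁ b)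
      ≡⟨ cong₂ (λ c₀ c₁ → c₀ + t * c₁) (constant b) (linear b) ⟩
    (v₀ + (e′ b + L sc b)) + t * (v₁ + B sc b)
      ≡⟨ distribute v₀ v₁ (e′ b) (L sc b) (B sc b) t ⟩
    v₀ + t * v₁ + (e′ b + (L sc b + t * B sc b)) ∎
  where
  open ≡-Reasoning
  expand : ∀ b → sum (λ a → e a * (L a b + t * B a b)) ≡ sum (λ a → e a * L a b) + t * sum (λ a → e a * B a b)
  expand b = trans (sum-cong-≗ (λ a → product (e a) (L a b) (B a b) t))
                   (∑-affine t (λ a → e a * L a b) (λ a → e a * B a b))
    where
    product : ∀ e l β t → e * (l + t * β) ≡ e * l + t * (e * β)
    product = solve-∀
  collect : ∀ e x y s₀ s₁ t → e + (x + t * y) + (s₀ + t * s₁) ≡ e + x + s₀ + t * (y + s₁)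
  collect = solve-∀
  distribute : ∀ v₀ v₁ e l β t → v₀ + (e + l) + t * (v₁ + β) ≡ v₀ + t * v₁ + (e + (l + t * β))
  distribute = solve-∀

-- The conditions of a Design, split along the powers of t.
record Family (k : ℕ) : Set where
  field
    scheme : Scheme k
  open Scheme scheme
  field
    prefix-balanced : ∀ b → sum (λ a → prefix-weight (rule a) b) ≡ p
    period-balanced : ∀ b → sum (λ a → period-weight (rule a) b) ≡ q
    reaches-start-constant  : ShapeTransition (λ b → δ root-colour b + prefix-weight root b) (λ a → prefix-weight (rule₁ a))
                               (prefix-weight special₁) (paint root 0) (shape start)
    reaches-start-linear    : ConstantlyAbove
      (λ b → period-weight root b
             + sum (λ a → (δ root-colour a + prefix-weight root a) * period-weight (rule₁ a) b
                          + period-weight root a * prefix-weight (rule₁ a) b)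
             + period-weight special₁ b)
      (period-weight (rule₁ (paint root 0)))
    reaches-start-quadratic : ConstantlyAbove (λ b → sum (λ a → period-weight root a * period-weight (rule₁ a) b)) (λ _ → 0)
    closed-constant : ∀ σ → ShapeTransition (shape σ) (λ a → prefix-weight (rule a)) (prefix-weight special) (paint root 0)
                              (shape (next σ))
    closed-linear   : ∀ σ → ConstantlyAbove
      (λ b → sum (λ a → shape σ a * period-weight (rule a) b) + period-weight special b)
      (period-weight (rule (paint root 0)))

family-design : ∀ {k} → Family k → ∀ t → Design k t
family-design F t = record
  { scheme       = scheme
  ; rule-balanced = λ b → trans (∑-affine t (λ a → prefix-weight (rule a) b) (λ a → period-weight (rule a) b))
                                   (cong₂ (λ x y → x + t * y) (prefix-balanced b) (period-balanced b))
  ; reaches-start = affine-transition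
                     {e₀ = λ b → δ root-colour b + prefix-weight root b} {e₁ = period-weight root}
                     {s₀ = prefix-weight special₁} {s₁ = period-weight special₁} {e′ = shape start}
                     {L = λ a → prefix-weight (rule₁ a)} {B = λ a → period-weight (rule₁ a)} {sc = paint root 0}
                     reaches-start-constant reaches-start-linear reaches-start-quadratic t
  ; closed       = λ σ → affine-transition-fixed
                     {e = shape σ} {s₀ = prefix-weight special} {s₁ = period-weight special} {e′ = shape (next σ)}
                     {L = λ a → prefix-weight (rule a)} {B = λ a → period-weight (rule a)} {sc = paint root 0}
                     (closed-constant σ) (closed-linear σ) t
  }
  where
  open Family F
  open Scheme scheme

-- Concrete designs (found by computer search)

rotate : ∀ {k} .{{_ : NonZero k}} → Fin k → Pattern k → Pattern k
rotate {k} a (xs then-repeat B) = List.map shift xs then-repeat List⁺.map shift B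
  where
  shift : Fin k → Fin k
  shift c = (toℕ a + toℕ c) mod k

valid-by-computation : ∀ {k p q} {a : Fin k} {P} {ok : True (valid? p q a P)} → Valid p q a P
valid-by-computation {ok = ok} = toWitness ok

all-valid-by-computation : ∀ {k p q} {R : Fin k → Pattern k} {ok : True (all? λ a → valid? p q a (R a))} →
  ∀ a → Valid p q a (R a)
all-valid-by-computation {ok = ok} = toWitness ok

pointwise-by-computation : ∀ {k} {f g : Fin k → ℕ} {ok : True (all? λ b → f b ℕ.≟ g b)} → ∀ b → f b ≡ g b
pointwise-by-computation {ok = ok} = toWitness ok

bounded-by-computation : ∀ {k n} {f : Fin n → Fin k → ℕ} {ok : True (all? λ σ → all? λ b → f σ b ≤? 1)} →
  ∀ σ b → f σ b ≤ 1
bounded-by-computation {ok = ok} = toWitness ok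

constantly-above-by-computation : ∀ {k} {f g : Fin (suc k) → ℕ} →
  {ok : True (all? λ b → f b ℕ.≟ (f zero ∸ g zero) + g b)} → ConstantlyAbove f g
constantly-above-by-computation {ok = ok} = _ , toWitness ok

all-constantly-above-by-computation : ∀ {k n} {f g : Fin n → Fin (suc k) → ℕ}
  {ok : True (all? λ σ → all? λ b → f σ b ℕ.≟ (f σ zero ∸ g σ zero) + g σ b)} →
  ∀ σ → ConstantlyAbove (f σ) (g σ)
all-constantly-above-by-computation {ok = ok} σ = _ , toWitness ok σ

pattern-2 : Pattern 3
pattern-2 = (# 1 ∷ # 2 ∷ []) then-repeat (# 1 ∷ # 2 ∷ [])

design-2 : Design 3 0
design-2 = record
  { scheme = record
    { p = 2 ; q = 2 ; root-colour = # 0 ; root = pattern-2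
    ; rule₁ = λ a → rotate a pattern-2 ; rule = λ a → rotate a pattern-2
    ; special₁ = rotate (# 1) pattern-2 ; special = rotate (# 1) pattern-2
    ; states = 1 ; shape = λ _ _ → 0 ; next = λ σ → σ ; start = zero
    ; root-valid = valid-by-computation
    ; rule₁-valid = all-valid-by-computation
    ; rule-valid = all-valid-by-computation
    ; special₁-valid = valid-by-computation
    ; special-valid = valid-by-computation
    ; shape-zero-one = bounded-by-computation
    }
  ; rule-balanced = pointwise-by-computation
  ; reaches-start = constantly-above-by-computation
  ; closed = all-constantly-above-by-computation
  }

pattern-3 : Pattern 3
pattern-3 = (# 1 ∷ # 2 ∷ # 1 ∷ []) then-repeat (# 2 ∷ # 1 ∷ [])

design-3 : Design 3 0
design-3 = record
  { scheme = record
    { p = 3 ; q = 2 ; root-colour = # 0 ; root = pattern-3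
    ; rule₁ = λ a → rotate a pattern-3 ; rule = λ a → rotate a pattern-3
    ; special₁ = rotate (# 1) pattern-3 ; special = rotate (# 1) pattern-3
    ; states = 3 ; shape = δ ; next = λ σ → (1 + toℕ σ) mod 3 ; start = # 2
    ; root-valid = valid-by-computation
    ; rule₁-valid = all-valid-by-computation
    ; rule-valid = all-valid-by-computation
    ; special₁-valid = valid-by-computation
    ; special-valid = valid-by-computation
    ; shape-zero-one = bounded-by-computation
    }
  ; rule-balanced = pointwise-by-computation
  ; reaches-start = constantly-above-by-computation
  ; closed = all-constantly-above-by-computation
  }

pattern-4 : Pattern 3
pattern-4 = (# 1 ∷ # 2 ∷ # 1 ∷ # 2 ∷ []) then-repeat (# 1 ∷ # 2 ∷ [])

design-4 : Design 3 0
design-4 = record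
  { scheme = record
    { p = 4 ; q = 2 ; root-colour = # 0 ; root = pattern-4
    ; rule₁ = λ a → rotate a pattern-4 ; rule = λ a → rotate a pattern-4
    ; special₁ = rotate (# 1) pattern-4 ; special = rotate (# 1) pattern-4
    ; states = 2 ; shape = λ { zero → δ (# 0) ; (suc _) → λ b → 1 ∸ δ (# 0) b }
    ; next = λ { zero → # 1 ; (suc _) → # 0 } ; start = # 0
    ; root-valid = valid-by-computation
    ; rule₁-valid = all-valid-by-computation
    ; rule-valid = all-valid-by-computation
    ; special₁-valid = valid-by-computation
    ; special-valid = valid-by-computation
    ; shape-zero-one = bounded-by-computation
    }
  ; rule-balanced = pointwise-by-computation
  ; reaches-start = constantly-above-by-computation
  ; closed = all-constantly-above-by-computation
  }

pattern-5 : Pattern 3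
pattern-5 = (# 1 ∷ # 2 ∷ # 1 ∷ # 2 ∷ # 1 ∷ []) then-repeat (# 2 ∷ # 1 ∷ [])

pattern-5-level-one : Fin 3 → Pattern 3
pattern-5-level-one zero             = pattern-5
pattern-5-level-one (suc zero)       = (# 2 ∷ # 0 ∷ # 2 ∷ # 0 ∷ # 2 ∷ []) then-repeat (# 0 ∷ # 2 ∷ [])
pattern-5-level-one (suc (suc zero)) = (# 1 ∷ # 0 ∷ # 1 ∷ # 0 ∷ # 1 ∷ []) then-repeat (# 0 ∷ # 1 ∷ [])

design-5 : Design 3 0
design-5 = record
  { scheme = record
    { p = 5 ; q = 2 ; root-colour = # 0 ; root = pattern-5
    ; rule₁ = pattern-5-level-one ; rule = λ a → rotate a pattern-5
    ; special₁ = (# 0 ∷ # 2 ∷ # 0 ∷ # 2 ∷ # 0 ∷ []) then-repeat (# 2 ∷ # 0 ∷ [])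
    ; special = rotate (# 1) pattern-5
    ; states = 1 ; shape = λ _ _ → 0 ; next = λ σ → σ ; start = zero
    ; root-valid = valid-by-computation
    ; rule₁-valid = all-valid-by-computation
    ; rule-valid = all-valid-by-computation
    ; special₁-valid = valid-by-computation
    ; special-valid = valid-by-computation
    ; shape-zero-one = bounded-by-computation
    }
  ; rule-balanced = pointwise-by-computation
  ; reaches-start = constantly-above-by-computation
  ; closed = all-constantly-above-by-computation
  }

pattern-0-mod-4 : Pattern 4
pattern-0-mod-4 = (# 1 ∷ # 2 ∷ # 3 ∷ # 2 ∷ []) then-repeat (# 1 ∷ # 2 ∷ # 3 ∷ # 2 ∷ [])

family-0-mod-4 : Family 4
family-0-mod-4 = record
  { scheme = record
    { p = 4 ; q = 4 ; root-colour = # 0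
    ; root = (# 1 ∷ # 2 ∷ # 1 ∷ # 3 ∷ []) then-repeat (# 1 ∷ # 3 ∷ # 1 ∷ # 3 ∷ [])
    ; rule₁ = λ a → rotate a pattern-0-mod-4 ; rule = λ a → rotate a pattern-0-mod-4
    ; special₁ = (# 0 ∷ # 2 ∷ # 0 ∷ # 3 ∷ []) then-repeat (# 0 ∷ # 2 ∷ # 0 ∷ # 2 ∷ [])
    ; special = (# 0 ∷ # 3 ∷ # 0 ∷ # 3 ∷ []) then-repeat (# 0 ∷ # 3 ∷ # 0 ∷ # 3 ∷ [])
    ; states = 1 ; shape = λ _ → δ (# 0) ; next = λ σ → σ ; start = zero
    ; root-valid = valid-by-computation
    ; rule₁-valid = all-valid-by-computation
    ; rule-valid = all-valid-by-computation
    ; special₁-valid = valid-by-computation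
    ; special-valid = valid-by-computation
    ; shape-zero-one = bounded-by-computation
    }
  ; prefix-balanced = pointwise-by-computation
  ; period-balanced = pointwise-by-computation
  ; reaches-start-constant = constantly-above-by-computation
  ; reaches-start-linear = constantly-above-by-computation
  ; reaches-start-quadratic = constantly-above-by-computation
  ; closed-constant = all-constantly-above-by-computation
  ; closed-linear = all-constantly-above-by-computation
  }

family-2-mod-4 : Family 4
family-2-mod-4 = record
  { scheme = record
    { p = 2 ; q = 4 ; root-colour = # 0
    ; root = (# 1 ∷ # 3 ∷ []) then-repeat (# 1 ∷ # 2 ∷ # 1 ∷ # 2 ∷ [])
    ; rule₁ = λ a → rotate a ((# 1 ∷ # 3 ∷ []) then-repeat (# 1 ∷ # 3 ∷ # 1 ∷ # 3 ∷ []))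
    ; rule = λ a → rotate a ((# 1 ∷ # 3 ∷ []) then-repeat (# 1 ∷ # 2 ∷ # 3 ∷ # 2 ∷ []))
    ; special₁ = (# 0 ∷ # 2 ∷ []) then-repeat (# 0 ∷ # 3 ∷ # 0 ∷ # 3 ∷ [])
    ; special = (# 0 ∷ # 2 ∷ []) then-repeat (# 0 ∷ # 3 ∷ # 0 ∷ # 3 ∷ [])
    ; states = 2 ; shape = λ { zero → δ (# 0) ; (suc _) → λ b → 1 ∸ δ (# 2) b }
    ; next = λ { zero → # 1 ; (suc _) → # 0 } ; start = # 0
    ; root-valid = valid-by-computation
    ; rule₁-valid = all-valid-by-computation
    ; rule-valid = all-valid-by-computation
    ; special₁-valid = valid-by-computation
    ; special-valid = valid-by-computation
    ; shape-zero-one = bounded-by-computation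
    }
  ; prefix-balanced = pointwise-by-computation
  ; period-balanced = pointwise-by-computation
  ; reaches-start-constant = constantly-above-by-computation
  ; reaches-start-linear = constantly-above-by-computation
  ; reaches-start-quadratic = constantly-above-by-computation
  ; closed-constant = all-constantly-above-by-computation
  ; closed-linear = all-constantly-above-by-computation
  }

family-odd : Family 4
family-odd = record
  { scheme = record
    { p = 1 ; q = 2 ; root-colour = # 0
    ; root = (# 2 ∷ []) then-repeat (# 1 ∷ # 3 ∷ [])
    ; rule₁ = λ a → rotate a odd-pattern ; rule = λ a → rotate a odd-pattern
    ; special₁ = rotate (# 2) odd-pattern ; special = rotate (# 2) odd-pattern
    ; states = 1 ; shape = λ _ _ → 0 ; next = λ σ → σ ; start = zero
    ; root-valid = valid-by-computation
    ; rule₁-valid = all-valid-by-computation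
    ; rule-valid = all-valid-by-computation
    ; special₁-valid = valid-by-computation
    ; special-valid = valid-by-computation
    ; shape-zero-one = bounded-by-computation
    }
  ; prefix-balanced = pointwise-by-computation
  ; period-balanced = pointwise-by-computation
  ; reaches-start-constant = constantly-above-by-computation
  ; reaches-start-linear = constantly-above-by-computation
  ; reaches-start-quadratic = constantly-above-by-computation
  ; closed-constant = all-constantly-above-by-computation
  ; closed-linear = all-constantly-above-by-computation
  }
  where
  odd-pattern : Pattern 4
  odd-pattern = (# 1 ∷ []) then-repeat (# 2 ∷ # 1 ∷ [])

root : ∀ m l → Fin (size (K1 ∘^ l ⟨ P m ⟩))
root m zero    = zero
root m (suc l) = Corona.old (K1 ∘^ l ⟨ P m ⟩) (P m) (root m l)

not-equitably-colourable-below-3 : ∀ m l j → j < 3 → ¬ EqColourable (K1 ∘^ suc l ⟨ P (2 + m) ⟩) j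
not-equitably-colourable-below-3 m l j j<3 (c , c-proper , _) =
  no-proper-colouring-below-3 (K1 ∘^ l ⟨ P (2 + m) ⟩) m (root (2 + m) l) j<3 c c-proper

path-length-cases : ∀ m → m ≡ 0 ⊎ ∃ λ t → m ≡ 1 + t * 2 ⊎ m ≡ 2 + t * 4 ⊎ m ≡ 4 + t * 4
path-length-cases 0 = inj₁ refl
path-length-cases 1 = inj₂ (0 , inj₁ refl)
path-length-cases 2 = inj₂ (0 , inj₂ (inj₁ refl))
path-length-cases 3 = inj₂ (1 , inj₁ refl)
path-length-cases (suc (suc (suc (suc m)))) with path-length-cases m
... | inj₁ refl                 = inj₂ (0 , inj₂ (inj₂ refl))
... | inj₂ (t , inj₁ refl)       = inj₂ (2 + t , inj₁ refl)
... | inj₂ (t , inj₂ (inj₁ refl)) = inj₂ (1 + t , inj₂ (inj₁ refl))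
... | inj₂ (t , inj₂ (inj₂ refl)) = inj₂ (1 + t , inj₂ (inj₂ refl))

equitably-4-colourable : ∀ m l → 1 ≤ m → EqColourable (K1 ∘^ (2 + l) ⟨ P m ⟩) 4
equitably-4-colourable (suc m) l _ with path-length-cases (suc m)
... | inj₁ ()
... | inj₂ (t , inj₁ refl)       = Construction.equitably-colourable (family-design family-odd t) l
... | inj₂ (t , inj₂ (inj₁ refl)) = Construction.equitably-colourable (family-design family-2-mod-4 t) l
... | inj₂ (t , inj₂ (inj₂ refl)) = Construction.equitably-colourable (family-design family-0-mod-4 t) l

equitably-3-colourable : ∀ m l → 2 ≤ m → m ≤ 5 → EqColourable (K1 ∘^ (2 + l) ⟨ P m ⟩) 3
equitably-3-colourable 2 l _ _ = Construction.equitably-colourable design-2 l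
equitably-3-colourable 3 l _ _ = Construction.equitably-colourable design-3 l
equitably-3-colourable 4 l _ _ = Construction.equitably-colourable design-4 l
equitably-3-colourable 5 l _ _ = Construction.equitably-colourable design-5 l
equitably-3-colourable 1 l (s≤s ()) _
equitably-3-colourable 0 l () _
equitably-3-colourable (suc (suc (suc (suc (suc (suc m)))))) l _ (s≤s (s≤s (s≤s (s≤s (s≤s ())))))

∃-function? : ∀ n {k} (Q : (Fin n → Fin k) → Set) → (∀ f g → (∀ i → f i ≡ g i) → Q f → Q g) →
  (∀ f → Dec (Q f)) → Dec (∃ Q)
∃-function? zero    Q respects Q? with Q? (λ ())
... | yes q = yes (_ , q)
... | no ¬q = no λ (f , q) → ¬q (respects f _ (λ ()) q)
∃-function? (suc n) Q respects Q?
  with any? (λ x → ∃-function? n (λ f → Q (x Vector.∷ f)) (λ f g f≗g → respects _ _ (∷-cong f≗g))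
                                  (λ f → Q? (x Vector.∷ f)))
  where
  ∷-cong : ∀ {x} {f g : Fin n → Fin _} → (∀ i → f i ≡ g i) → ∀ i → (x Vector.∷ f) i ≡ (x Vector.∷ g) i
  ∷-cong f≗g zero    = refl
  ∷-cong f≗g (suc i) = f≗g i
... | yes (x , f , q) = yes (_ , q)
... | no ¬q = no λ (f , q) → ¬q (f zero , (λ i → f (suc i)) , respects f _ (λ { zero → refl ; (suc i) → refl }) q)

equitably-colourable? : ∀ G k → Dec (EqColourable G k)
equitably-colourable? G k = ∃-function? (size G) (λ c → Proper G c × Equitable G c) respects decide
  where
  respects : ∀ c d → (∀ u → c u ≡ d u) → Proper G c × Equitable G c → Proper G d × Equitable G d
  respects c d c≗d (c-proper , c-equitable) =
    (λ u v e same → c-proper u v e (trans (c≗d u) (trans same (sym (c≗d v))))) ,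
    (λ a b → subst₂ (λ x y → x ≤ suc y) (classSize-cong G c≗d a) (classSize-cong G c≗d b) (c-equitable a b))
  decide : ∀ c → Dec (Proper G c × Equitable G c)
  decide c = all? (λ u → all? λ v → (adj G u v ≟ᵇ true) →-dec ¬? (c u Fin.≟ c v)) ×-dec
             all? (λ a → all? λ b → classSize G c a ≤? suc (classSize G c b))

below-4 : ∀ {G} → ¬ EqColourable G 3 → (∀ j → j < 3 → ¬ EqColourable G j) →
  ∀ j → j < 4 → ¬ EqColourable G j
below-4 ¬3 below-3 j j<4 with m<1+n⇒m<n∨m≡n j<4
... | inj₁ j<3  = below-3 j j<3
... | inj₂ refl = ¬3

chromatic-number-≤-4 : ∀ m l → ∃ λ k → EqChromatic (K1 ∘^ (2 + l) ⟨ P (2 + m) ⟩) k × k ≤ 4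
chromatic-number-≤-4 m l with equitably-colourable? (K1 ∘^ (2 + l) ⟨ P (2 + m) ⟩) 3
... | yes three = 3 , (three , not-equitably-colourable-below-3 m (suc l)) , n≤1+n 3
... | no ¬three =
  4 , (equitably-4-colourable (2 + m) l (s≤s z≤n) , below-4 ¬three (not-equitably-colourable-below-3 m (suc l))) , ≤-refl

chromatic-number-even : ∀ m l → 6 ≤ m → 2 ∣ m → EqChromatic (K1 ∘^ (2 + l) ⟨ P m ⟩) 4
chromatic-number-even _ l _ (divides (suc (suc (suc h′))) refl) =
  equitably-4-colourable _ l (s≤s z≤n) ,
  below-4 (no-equitable-3-colouring h′ (suc l)) (not-equitably-colourable-below-3 (4 + h′ * 2) (suc l))
chromatic-number-even _ l ()                                (divides 0 refl)
chromatic-number-even _ l (s≤s (s≤s ()))                    (divides 1 refl)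
chromatic-number-even _ l (s≤s (s≤s (s≤s (s≤s ()))))        (divides 2 refl)

theorem8 : (m l : ℕ) → 2 ≤ m → 2 ≤ l →
    (m ≤ 5 → EqChromatic (K1 ∘^ l ⟨ P m ⟩) 3) ×
    (6 ≤ m → 2 ∣ m → EqChromatic (K1 ∘^ l ⟨ P m ⟩) 4) ×
    (6 ≤ m → ¬ (2 ∣ m) → ∃ λ k → EqChromatic (K1 ∘^ l ⟨ P m ⟩) k × k ≤ 4)
theorem8 (suc (suc m)) (suc (suc l)) _ _ =
  (λ m≤5 → equitably-3-colourable (2 + m) l (s≤s (s≤s z≤n)) m≤5 ,
           not-equitably-colourable-below-3 m (suc l)) ,
  chromatic-number-even (2 + m) l ,
  (λ _ _ → chromatic-number-≤-4 m l)
theorem8 (suc zero) _ (s≤s ()) _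
theorem8 _ (suc zero) _ (s≤s ())
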